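{- For binary evolutionary networks, the properties of being level-1, being 1-nested, being a weakly galled tree, and being a galled tree are all equivalent.
   Context: An evolutionary network is a rooted directed acyclic graph whose leaves are bijectively labeled by a set of taxa. A tree node is a node of in-degree at most 1; a hybrid node is a node of in-degree at least 2. A network is binary (fully resolved) when every hybrid node has in-degree 2 and out-degree 1 and every internal tree node has out-degree 2. A reticulation cycle for a hybrid node $h$ is a pair of distinct non-trivial directed paths with a common origin (the split node), both ending in $h$ (the end), that have no intermediate (non-endpoint) nodes in common; its intermediate nodes are those of the two paths. A network is 1-nested when every pair of reticulation cycles with different ends have disjoint sets of intermediate nodes; a weakly galled tree when every pair of distinct reticulation cycles have disjoint sets of arcs; a galled tree when every pair of distinct reticulation cycles have disjoint sets of nodes; and level-1 when no biconnected subgraph (biconnected in the underlying undirected graph) contains more than one hybrid node. -}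

module Defs where

open import Data.Nat using (ℕ; zero; suc; _≤_)
open import Data.Fin using (Fin)
open import Data.Bool using (Bool; true; false; T; if_then_else_)
open import Data.List using (List; []; _∷_; _++_; map; allFin)
open import Data.Nat.ListAction using (sum)
open import Data.List.Membership.Propositional using (_∈_; _∉_)
open import Data.Product using (_×_; _,_; ∃)
open import Data.Sum using (_⊎_)
open import Relation.Nullary using (¬_)
open import Relation.Binary.PropositionalEquality using (_≡_; _≢_)

Adj : ℕ → Set
Adj n = Fin n → Fin n → Bool

-- Non-trivial directed path from x to y whose list of intermediate
-- (non-endpoint) nodes is ms (in order).
data Walk {n : ℕ} (E : Adj n) : Fin n → Fin n → List (Fin n) → Set where
  edge : ∀ {x y} → T (E x y) → Walk E x y []
  step : ∀ {x z y ms} → T (E x z) → Walk E z y ms → Walk E x y (z ∷ ms)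

walkArcs : ∀ {n} {E : Adj n} {x y ms} → Walk E x y ms → List (Fin n × Fin n)
walkArcs {x = x} {y = y} (edge _) = (x , y) ∷ []
walkArcs {x = x} (step {z = z} _ w) = (x , z) ∷ walkArcs w

indeg : ∀ {n} → Adj n → Fin n → ℕ
indeg {n} E v = sum (map (λ u → if E u v then 1 else 0) (allFin n))

outdeg : ∀ {n} → Adj n → Fin n → ℕ
outdeg {n} E v = sum (map (λ w → if E v w then 1 else 0) (allFin n))

-- Evolutionary networks (rooted DAGs).  The bijective leaf labelling by
-- taxa is irrelevant to all properties considered.

record Network : Set where
  field
    n       : ℕ
    arc     : Adj n
    acyclic : ∀ v ms → ¬ Walk arc v v ms
    root    : Fin n
    root-in : indeg arc root ≡ 0
    root-unique : ∀ v → indeg arc v ≡ 0 → v ≡ root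

module _ (N : Network) where
  open Network N

  Hybrid : Fin n → Set
  Hybrid v = 2 ≤ indeg arc v

  TreeNode : Fin n → Set
  TreeNode v = indeg arc v ≤ 1

  Binary : Set
  Binary = ∀ v → (Hybrid v → indeg arc v ≡ 2 × outdeg arc v ≡ 1)
               × (TreeNode v → ¬ outdeg arc v ≡ 0 → outdeg arc v ≡ 2)

  record RetCycle : Set where
    field
      split end : Fin n
      int₁ int₂ : List (Fin n)
      path₁ : Walk arc split end int₁
      path₂ : Walk arc split end int₂
      distinctPaths : int₁ ≢ int₂
      noCommonInt   : ∀ x → x ∈ int₁ → x ∉ int₂

  open RetCycle

  -- a reticulation cycle is an (unordered) pair of paths
  SameCycle : RetCycle → RetCycle → Set
  SameCycle C D = split C ≡ split D × end C ≡ end D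
    × ((int₁ C ≡ int₁ D × int₂ C ≡ int₂ D) ⊎ (int₁ C ≡ int₂ D × int₂ C ≡ int₁ D))

  intermediates : RetCycle → List (Fin n)
  intermediates C = int₁ C ++ int₂ C

  cycleNodes : RetCycle → List (Fin n)
  cycleNodes C = split C ∷ end C ∷ intermediates C

  cycleArcs : RetCycle → List (Fin n × Fin n)
  cycleArcs C = walkArcs (path₁ C) ++ walkArcs (path₂ C)

  Disjoint : {A : Set} → List A → List A → Set
  Disjoint xs ys = ∀ x → x ∈ xs → x ∉ ys

  OneNested : Set
  OneNested = ∀ C D → end C ≢ end D → Disjoint (intermediates C) (intermediates D)

  WeaklyGalledTree : Set
  WeaklyGalledTree = ∀ C D → ¬ SameCycle C D → Disjoint (cycleArcs C) (cycleArcs D)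

  GalledTree : Set
  GalledTree = ∀ C D → ¬ SameCycle C D → Disjoint (cycleNodes C) (cycleNodes D)

  record Subgraph : Set₁ where
    field
      S : Fin n → Set
      A : Fin n → Fin n → Set
      A⊆arc : ∀ u v → A u v → T (arc u v)
      A⊆S   : ∀ u v → A u v → S u × S v

  data UConn (P : Fin n → Set) (A : Fin n → Fin n → Set) : Fin n → Fin n → Set where
    here  : ∀ {u} → P u → UConn P A u u
    there : ∀ {u w v} → P u → (A u w ⊎ A w u) → UConn P A w v → UConn P A u v

  Biconnected : Subgraph → Set
  Biconnected G =
      (∀ u v → S u → S v → UConn S A u v)
    × (∀ x u v → S x → S u → S v → u ≢ x → v ≢ x
         → UConn (λ w → S w × w ≢ x) A u v)
    where open Subgraph G

  Level1 : Set₁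
  Level1 = ∀ (G : Subgraph) → Biconnected G
         → ∀ h₁ h₂ → Subgraph.S G h₁ → Subgraph.S G h₂
         → Hybrid h₁ → Hybrid h₂ → h₁ ≡ h₂

module Submission where

-- We prove GT ⇔ WGT ⇒ ON ⇒ GT ⇒ L1 ⇒ ON.  Binarity enters only through degree bounds (Section 6):
-- a hybrid node has exactly two parents and one child, a tree node with
-- two children has no others.  From these, two reticulation cycles through
-- a common node share an arc there (Section 7), which gives GT ⇔ WGT ⇒ ON.
-- Every hybrid node ends a cycle, extracted from two root paths to its
-- parents (Section 8).  For ON ⇒ GT (Section 9) a cycle end is never
-- intermediate in another cycle, so inner nodes are tree nodes and a
-- cycle is determined by its end.  For L1 ⇒ ON (Sections 10-11) the union
-- of two cycles sharing an arc is biconnected and contains both ends.  For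
-- GT ⇒ L1 (Sections 12-13), a connection avoiding one node between two
-- hybrid nodes of a biconnected subgraph must enter the descendants of a
-- suitable node from outside, which produces a second cycle through a node
-- of the first.

open import Defs
open import Data.Nat using (ℕ; zero; suc; _≤_; z≤n; s≤s)
open import Data.Nat.Properties using (≤-trans; m≤n+m; ≤-reflexive; ≤-pred; _≤?_; ≰⇒>; <-irrefl)
open import Data.Fin using (Fin; zero; suc; _≟_)
open import Data.Fin.Properties using (suc-injective)
open import Data.Fin.Induction using (spo-wellFounded)
open import Induction.WellFounded using (Acc; acc)
open import Relation.Binary.Structures using (IsStrictPartialOrder)
open import Data.Bool using (Bool; true; false; T; if_then_else_)
open import Data.Unit using (tt)
open import Data.Empty using (⊥; ⊥-elim)
open import Data.List using (List; []; _∷_; _++_; tabulate; [_])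
open import Data.List.Properties using (map-tabulate; ∷-injectiveʳ; ++-conicalˡ; ++-conicalʳ)
open import Data.Nat.ListAction using (sum)
open import Data.List.Membership.Propositional using (_∈_; _∉_)
open import Data.List.Membership.Propositional.Properties using (∈-++⁺ˡ; ∈-++⁺ʳ; ∈-++⁻; ∈-∃++)
open import Data.List.Relation.Unary.Any using (here; there)
open import Data.Product using (_×_; _,_; Σ; proj₁; proj₂)
open import Data.Sum using (_⊎_; inj₁; inj₂)
open import Relation.Nullary using (¬_; yes; no)
open import Relation.Nullary.Decidable using (¬¬-excluded-middle)
open import Relation.Binary.PropositionalEquality using (_≡_; _≢_; refl; sym; trans; cong; subst; isEquivalence)
open import Function.Bundles using (_⇔_; mk⇔)

-- 1. Counting the true values of a Boolean predicate on Fin n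

indicator : Bool → ℕ
indicator b = if b then 1 else 0

count : ∀ n → (Fin n → Bool) → ℕ
count n f = sum (tabulate (λ i → indicator (f i)))

indicator-T : ∀ b → T b → indicator b ≡ 1
indicator-T true _ = refl

count-tail : ∀ n (f : Fin (suc n) → Bool) {k} → k ≤ count n (λ i → f (suc i)) → k ≤ count (suc n) f
count-tail n f le = ≤-trans le (m≤n+m _ (indicator (f zero)))

count-≥1 : ∀ n f (u : Fin n) → T (f u) → 1 ≤ count n f
count-≥1 (suc n) f zero t rewrite indicator-T (f zero) t = s≤s z≤n
count-≥1 (suc n) f (suc u) t = count-tail n f (count-≥1 n (λ i → f (suc i)) u t)

count-≥2 : ∀ n f (u w : Fin n) → u ≢ w → T (f u) → T (f w) → 2 ≤ count n f
count-≥2 (suc n) f zero zero ne _ _ = ⊥-elim (ne refl)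
count-≥2 (suc n) f zero (suc w) ne tu tw rewrite indicator-T (f zero) tu = s≤s (count-≥1 n _ w tw)
count-≥2 (suc n) f (suc u) zero ne tu tw rewrite indicator-T (f zero) tw = s≤s (count-≥1 n _ u tu)
count-≥2 (suc n) f (suc u) (suc w) ne tu tw =
  count-tail n f (count-≥2 n (λ i → f (suc i)) u w (λ e → ne (cong suc e)) tu tw)

count-≥3 : ∀ n f (u w x : Fin n) → u ≢ w → u ≢ x → w ≢ x → T (f u) → T (f w) → T (f x) → 3 ≤ count n f
count-≥3 (suc n) f zero zero x uw ux wx _ _ _ = ⊥-elim (uw refl)
count-≥3 (suc n) f zero (suc w) zero uw ux wx _ _ _ = ⊥-elim (ux refl)
count-≥3 (suc n) f (suc u) zero zero uw ux wx _ _ _ = ⊥-elim (wx refl)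
count-≥3 (suc n) f zero (suc w) (suc x) uw ux wx tu tw tx rewrite indicator-T (f zero) tu =
  s≤s (count-≥2 n _ w x (λ e → wx (cong suc e)) tw tx)
count-≥3 (suc n) f (suc u) zero (suc x) uw ux wx tu tw tx rewrite indicator-T (f zero) tw =
  s≤s (count-≥2 n _ u x (λ e → ux (cong suc e)) tu tx)
count-≥3 (suc n) f (suc u) (suc w) zero uw ux wx tu tw tx rewrite indicator-T (f zero) tx =
  s≤s (count-≥2 n _ u w (λ e → uw (cong suc e)) tu tw)
count-≥3 (suc n) f (suc u) (suc w) (suc x) uw ux wx tu tw tx =
  count-tail n f (count-≥3 n (λ i → f (suc i)) u w x
                    (λ e → uw (cong suc e)) (λ e → ux (cong suc e)) (λ e → wx (cong suc e)) tu tw tx)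

count-witness : ∀ n f → 1 ≤ count n f → Σ (Fin n) λ u → T (f u)
count-witness (suc n) f le with f zero in eq
... | true = zero , subst T (sym eq) tt
... | false with count-witness n (λ i → f (suc i)) le
...   | u , t = suc u , t

count-witness₂ : ∀ n f → 2 ≤ count n f →
                 Σ (Fin n) λ u → Σ (Fin n) λ w → u ≢ w × T (f u) × T (f w)
count-witness₂ (suc n) f le with f zero in eq
... | true with count-witness n (λ i → f (suc i)) (≤-pred le)
...   | w , t = zero , suc w , (λ ()) , subst T (sym eq) tt , t
count-witness₂ (suc n) f le | false with count-witness₂ n (λ i → f (suc i)) le
...   | u , w , ne , tu , tw = suc u , suc w , (λ e → ne (suc-injective e)) , tu , tw

indeg≡count : ∀ {n} (E : Adj n) v → indeg E v ≡ count n (λ u → E u v)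
indeg≡count E v = cong sum (map-tabulate (λ i → i) (λ u → indicator (E u v)))

outdeg≡count : ∀ {n} (E : Adj n) v → outdeg E v ≡ count n (λ w → E v w)
outdeg≡count E v = cong sum (map-tabulate (λ i → i) (λ w → indicator (E v w)))

-- refutation by cases on an arbitrary proposition (constructively valid)
refuteByCases : {P : Set} → (P → ⊥) → (¬ P → ⊥) → ⊥
refuteByCases yes-case no-case =
  ¬¬-excluded-middle λ { (yes p) → yes-case p ; (no ¬p) → no-case ¬p }

module _ {A : Set} where

  -- lastOf a xs: the last element of a ∷ xs (the node before the end of a path)
  lastOf : A → List A → A
  lastOf a [] = a
  lastOf a (x ∷ xs) = lastOf x xs

  -- headOr t xs: the first element of xs ++ [ t ] (the node after the start of a path)
  headOr : A → List A → A
  headOr t [] = t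
  headOr t (x ∷ xs) = x

  lastOf-∈ : ∀ a xs → lastOf a xs ≡ a ⊎ lastOf a xs ∈ xs
  lastOf-∈ a [] = inj₁ refl
  lastOf-∈ a (x ∷ xs) with lastOf-∈ x xs
  ... | inj₁ e = inj₂ (here e)
  ... | inj₂ m = inj₂ (there m)

  headOr-∈ : ∀ t xs → headOr t xs ≡ t ⊎ headOr t xs ∈ xs
  headOr-∈ t [] = inj₁ refl
  headOr-∈ t (x ∷ xs) = inj₂ (here refl)

  lastOf-++ : ∀ a xs b ys → lastOf a (xs ++ b ∷ ys) ≡ lastOf b ys
  lastOf-++ a [] b ys = refl
  lastOf-++ a (x ∷ xs) b ys = lastOf-++ x xs b ys

  lastOf-split : ∀ {r : A} {ms : List A} pre x I → r ∷ ms ≡ pre ++ x ∷ I → lastOf r ms ≡ lastOf x I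
  lastOf-split {r} pre x I eq = trans (cong (lastOf r) eq) (lastOf-++ r pre x I)

  lastOf-[] : ∀ a xs → lastOf a xs ≡ a → a ∉ xs → xs ≡ []
  lastOf-[] a [] e n = refl
  lastOf-[] a (x ∷ xs) e n with lastOf-∈ x xs
  ... | inj₁ e' = ⊥-elim (n (here (trans (sym e) e')))
  ... | inj₂ m = ⊥-elim (n (subst (_∈ (x ∷ xs)) e (there m)))

  nonEmpty : (xs : List A) → xs ≢ [] → Σ A λ y → y ∈ xs
  nonEmpty [] ne = ⊥-elim (ne refl)
  nonEmpty (x ∷ xs) ne = x , here refl

  suffix-⊆ : ∀ (L₁ L₂ : List A) a b I P → L₁ ++ a ∷ I ≡ L₂ ++ b ∷ P → a ∉ P →
             ∀ z → z ∈ b ∷ P → z ∈ a ∷ I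
  suffix-⊆ [] [] a b I P refl nP z m = m
  suffix-⊆ [] (x ∷ L₂) a b I P refl nP z m = there (∈-++⁺ʳ L₂ m)
  suffix-⊆ (x ∷ L₁) [] a b I P refl nP z m = ⊥-elim (nP (∈-++⁺ʳ L₁ (here refl)))
  suffix-⊆ (x ∷ L₁) (y ∷ L₂) a b I P e nP = suffix-⊆ L₁ L₂ a b I P (∷-injectiveʳ e) nP

  suffix-∈ : ∀ {r : A} {L : List A} pre x I {y} → r ∷ L ≡ pre ++ x ∷ I → y ∈ I → y ∈ L
  suffix-∈ [] x I refl m = m
  suffix-∈ (p ∷ pre) x I refl m = ∈-++⁺ʳ pre (there m)

pickAvoiding : ∀ {m} (a b c : Fin m) → a ≢ b → a ≢ c → b ≢ c → ∀ u v →
               Σ (Fin m) λ x → u ≢ x × v ≢ x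
pickAvoiding a b c ab ac bc u v with u ≟ a
... | no ua with v ≟ a
...   | no va = a , ua , va
...   | yes refl with u ≟ b
...     | no ub = b , ub , ab
...     | yes refl = c , bc , ac
pickAvoiding a b c ab ac bc u v | yes refl with v ≟ b
... | no vb = b , ab , vb
... | yes refl = c , ac , bc

module _ {m : ℕ} where
  open import Data.List.Membership.DecPropositional (_≟_ {n = m}) using (_∈?_)

  lastMember : (M L : List (Fin m)) →
               (Σ (List (Fin m)) λ pre → Σ (Fin m) λ x → Σ (List (Fin m)) λ I →
                  L ≡ pre ++ x ∷ I × x ∈ M × (∀ y → y ∈ I → y ∉ M))
               ⊎ (∀ y → y ∈ L → y ∉ M)
  lastMember M [] = inj₂ (λ y ())
  lastMember M (x ∷ L) with lastMember M L
  ... | inj₁ (pre , y , I , refl , yM , nI) = inj₁ (x ∷ pre , y , I , refl , yM , nI)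
  ... | inj₂ nL with x ∈? M
  ...   | yes xM = inj₁ ([] , x , L , refl , xM , nL)
  ...   | no xM = inj₂ λ { y (here refl) → xM ; y (there m) → nL y m }

-- 3. Paths in an arbitrary directed graph

module _ {n : ℕ} {E : Adj n} where

  lastArc : ∀ {a t ms} → Walk E a t ms → T (E (lastOf a ms) t)
  lastArc (edge e) = e
  lastArc (step e w) = lastArc w

  firstArc : ∀ {a t ms} → Walk E a t ms → T (E a (headOr t ms))
  firstArc (edge e) = e
  firstArc (step e w) = e

  _++ʷ_ : ∀ {a u t ms₁ ms₂} → Walk E a u ms₁ → Walk E u t ms₂ → Walk E a t (ms₁ ++ u ∷ ms₂)
  edge e ++ʷ w₂ = step e w₂
  step e w ++ʷ w₂ = step e (w ++ʷ w₂)

  splitWalk : ∀ {a t ms u} → Walk E a t ms → u ∈ ms →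
              Σ (List (Fin n)) λ ms₁ → Σ (List (Fin n)) λ ms₂ →
                ms ≡ ms₁ ++ u ∷ ms₂ × Walk E a u ms₁ × Walk E u t ms₂
  splitWalk (step e w) (here refl) = [] , _ , refl , edge e , w
  splitWalk (step e w) (there m) with splitWalk w m
  ... | ms₁ , ms₂ , refl , w₁ , w₂ = _ ∷ ms₁ , ms₂ , refl , step e w₁ , w₂

  replaceLast : ∀ {a t t' ms K} → Walk E a t ms → Walk E (lastOf a ms) t' K → Walk E a t' (ms ++ K)
  replaceLast (edge e) w = w
  replaceLast (step e w) w' = step e (replaceLast w w')

  suffixWalk : ∀ {a t ms} pre x I → Walk E a t ms → a ∷ ms ≡ pre ++ x ∷ I → Walk E x t I
  suffixWalk [] x I w refl = w
  suffixWalk (p ∷ []) x I (step e w) refl = w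
  suffixWalk (p ∷ q ∷ pre) x I (step e w) refl = suffixWalk (q ∷ pre) x I w refl

  walkArc : ∀ {a t ms u v} (w : Walk E a t ms) → (u , v) ∈ walkArcs w → T (E u v)
  walkArc (edge e) (here refl) = e
  walkArc (step e w) (here refl) = e
  walkArc (step e w) (there m) = walkArc w m

  arcSource : ∀ {a t ms u v} (w : Walk E a t ms) → (u , v) ∈ walkArcs w → u ≡ a ⊎ u ∈ ms
  arcSource (edge e) (here refl) = inj₁ refl
  arcSource (step e w) (here refl) = inj₁ refl
  arcSource (step e w) (there m) with arcSource w m
  ... | inj₁ refl = inj₂ (here refl)
  ... | inj₂ m' = inj₂ (there m')

  arcTarget : ∀ {a t ms u v} (w : Walk E a t ms) → (u , v) ∈ walkArcs w → v ≡ t ⊎ v ∈ ms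
  arcTarget (edge e) (here refl) = inj₁ refl
  arcTarget (step e w) (here refl) = inj₂ (here refl)
  arcTarget (step e w) (there m) with arcTarget w m
  ... | inj₁ refl = inj₁ refl
  ... | inj₂ m' = inj₂ (there m')

  lastArc∈ : ∀ {a t ms} (w : Walk E a t ms) → (lastOf a ms , t) ∈ walkArcs w
  lastArc∈ (edge e) = here refl
  lastArc∈ (step e w) = there (lastArc∈ w)

  firstArc∈ : ∀ {a t ms} (w : Walk E a t ms) → (a , headOr t ms) ∈ walkArcs w
  firstArc∈ (edge e) = here refl
  firstArc∈ (step e w) = here refl

  incomingArc : ∀ {a t ms u} (w : Walk E a t ms) → u ∈ ms → Σ (Fin n) λ p → (p , u) ∈ walkArcs w
  incomingArc (step e w) (here refl) = _ , here refl
  incomingArc (step e w) (there m) with incomingArc w m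
  ... | p , pa = p , there pa

  outgoingArc : ∀ {a t ms u} (w : Walk E a t ms) → u ∈ ms → Σ (Fin n) λ s → (u , s) ∈ walkArcs w
  outgoingArc (step {ms = []} e (edge e')) (here refl) = _ , there (here refl)
  outgoingArc (step {ms = _ ∷ _} e (step e' w)) (here refl) = _ , there (here refl)
  outgoingArc (step e w) (there m) with outgoingArc w m
  ... | s , sa = s , there sa

  crossWalk : ∀ (R : Fin n → Set) {a t ms} → Walk E a t ms → R a → ¬ R t →
              (∀ y y' → T (E y y') → R y → ¬ R y' → (y' ≡ t ⊎ y' ∈ ms) → ⊥) → ⊥
  crossWalk R (edge e) ra nrt k = k _ _ e ra nrt (inj₁ refl)
  crossWalk R (step e w) ra nrt k =
    refuteByCases (λ rz → crossWalk R w rz nrt (λ y y' e' a b pos → k y y' e' a b (later pos)))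
                  (λ nrz → k _ _ e ra nrz (inj₂ (here refl)))
    where
      later : ∀ {y' z t ms} → y' ≡ t ⊎ y' ∈ ms → y' ≡ t ⊎ y' ∈ z ∷ ms
      later (inj₁ e) = inj₁ e
      later (inj₂ m) = inj₂ (there m)

  data BackWalk : Fin n → Fin n → List (Fin n) → Set where
    bedge : ∀ {x y} → T (E x y) → BackWalk x y []
    bsnoc : ∀ {x z y ms} → BackWalk x z ms → T (E z y) → BackWalk x y (ms ++ [ z ])

  private
    bcons : ∀ {x z y ms} → T (E x z) → BackWalk z y ms → BackWalk x y (z ∷ ms)
    bcons e (bedge e') = bsnoc (bedge e) e'
    bcons e (bsnoc w e') = bsnoc (bcons e w) e'

    toBackWalk : ∀ {x y ms} → Walk E x y ms → BackWalk x y ms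
    toBackWalk (edge e) = bedge e
    toBackWalk (step e w) = bcons e (toBackWalk w)

    penultimate : ∀ {x y ms} → BackWalk x y ms → Fin n
    penultimate {x} (bedge _) = x
    penultimate (bsnoc {z = z} _ _) = z

    penultimate-arc : ∀ {x y ms} (w : BackWalk x y ms) → T (E (penultimate w) y)
    penultimate-arc (bedge e) = e
    penultimate-arc (bsnoc _ e) = e

    penultimate≡lastOf : ∀ {x y ms} (w : BackWalk x y ms) → penultimate w ≡ lastOf x ms
    penultimate≡lastOf (bedge _) = refl
    penultimate≡lastOf {x} (bsnoc {z = z} {ms = ms} _ _) = sym (lastOf-++ x ms z [])

    backUnique : ∀ {a b u ms₁ ms₂} (w₁ : BackWalk a u ms₁) (w₂ : BackWalk b u ms₂) →
                 penultimate w₁ ≡ penultimate w₂ →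
                 (∀ y → y ∈ ms₁ → ∀ {p q} → T (E p y) → T (E q y) → p ≡ q) →
                 (a ≡ b × ms₁ ≡ ms₂) ⊎ (a ∈ ms₂ ⊎ b ∈ ms₁)
    backUnique (bedge _) (bedge _) pe uniq = inj₁ (pe , refl)
    backUnique (bedge _) (bsnoc {ms = ms} _ _) pe uniq = inj₂ (inj₁ (∈-++⁺ʳ ms (here pe)))
    backUnique (bsnoc {ms = ms} _ _) (bedge _) pe uniq = inj₂ (inj₂ (∈-++⁺ʳ ms (here (sym pe))))
    backUnique (bsnoc {z = z} {ms = ms₁} w₁ e₁) (bsnoc {ms = ms₂} w₂ e₂) refl uniq
      with backUnique w₁ w₂ (uniq z (∈-++⁺ʳ ms₁ (here refl)) (penultimate-arc w₁) (penultimate-arc w₂))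
                      (λ y m → uniq y (∈-++⁺ˡ m))
    ... | inj₁ (ab , refl) = inj₁ (ab , refl)
    ... | inj₂ (inj₁ m) = inj₂ (inj₁ (∈-++⁺ˡ m))
    ... | inj₂ (inj₂ m) = inj₂ (inj₂ (∈-++⁺ˡ m))

  -- Two paths entering their common end through the same arc, whose inner
  -- nodes (on the first path) have a unique parent, can be traced back
  -- together: they coincide, or one starts on the other.
  sameLastArc : ∀ {a b u ms₁ ms₂} → Walk E a u ms₁ → Walk E b u ms₂ → lastOf a ms₁ ≡ lastOf b ms₂ →
                (∀ y → y ∈ ms₁ → ∀ {p q} → T (E p y) → T (E q y) → p ≡ q) →
                (a ≡ b × ms₁ ≡ ms₂) ⊎ (a ∈ ms₂ ⊎ b ∈ ms₁)
  sameLastArc w₁ w₂ eq uniq =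
    backUnique (toBackWalk w₁) (toBackWalk w₂)
      (trans (penultimate≡lastOf (toBackWalk w₁)) (trans eq (sym (penultimate≡lastOf (toBackWalk w₂)))))
      uniq

-- 4. Ancestry in a network

module NetworkFacts (N : Network) where
  open Network N public

  Arc : Fin n → Fin n → Set
  Arc u v = T (arc u v)

  _⊏_ : Fin n → Fin n → Set
  a ⊏ b = Σ (List (Fin n)) λ ms → Walk arc a b ms

  ⊏-trans : ∀ {a b c} → a ⊏ b → b ⊏ c → a ⊏ c
  ⊏-trans (_ , w₁) (_ , w₂) = _ , (w₁ ++ʷ w₂)

  ⊏-irrefl : ∀ {a} → a ⊏ a → ⊥
  ⊏-irrefl (ms , w) = acyclic _ ms w

  ⊏-asym : ∀ {a b} → a ⊏ b → b ⊏ a → ⊥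
  ⊏-asym p q = ⊏-irrefl (⊏-trans p q)

  ⊏-arc : ∀ {a b} → Arc a b → a ⊏ b
  ⊏-arc e = [] , edge e

  ⊏-≢ : ∀ {a b} → a ⊏ b → a ≢ b
  ⊏-≢ p refl = ⊏-irrefl p

  ⊏-isStrictPartialOrder : IsStrictPartialOrder _≡_ _⊏_
  ⊏-isStrictPartialOrder = record
    { isEquivalence = isEquivalence
    ; irrefl = λ { refl p → ⊏-irrefl p }
    ; trans = ⊏-trans
    ; <-resp-≈ = (λ { refl p → p }) , (λ { refl p → p }) }

  from-intermediate : ∀ {a t ms u} → Walk arc a t ms → u ∈ ms → a ⊏ u
  from-intermediate w m with splitWalk w m
  ... | _ , _ , _ , w₁ , _ = _ , w₁

  to-intermediate : ∀ {a t ms u} → Walk arc a t ms → u ∈ ms → u ⊏ t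
  to-intermediate w m with splitWalk w m
  ... | _ , _ , _ , _ , w₂ = _ , w₂

  start∉ : ∀ {a t ms} → Walk arc a t ms → a ∉ ms
  start∉ w m = ⊏-irrefl (from-intermediate w m)

  end∉ : ∀ {a t ms} → Walk arc a t ms → t ∉ ms
  end∉ w m = ⊏-irrefl (to-intermediate w m)

  start≢end : ∀ {a t ms} → Walk arc a t ms → a ≢ t
  start≢end w = ⊏-≢ (_ , w)

  _≼_ : Fin n → Fin n → Set
  a ≼ b = a ≡ b ⊎ a ⊏ b

  ≼-arc : ∀ {z u v} → z ≼ u → Arc u v → z ≼ v
  ≼-arc (inj₁ refl) e = inj₂ (⊏-arc e)
  ≼-arc (inj₂ p) e = inj₂ (⊏-trans p (⊏-arc e))

  ≼-trans : ∀ {a b c} → a ≼ b → b ≼ c → a ≼ c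
  ≼-trans (inj₁ refl) q = q
  ≼-trans (inj₂ p) (inj₁ refl) = inj₂ p
  ≼-trans (inj₂ p) (inj₂ q) = inj₂ (⊏-trans p q)

  ⊏-≼-trans : ∀ {a b c} → a ⊏ b → b ≼ c → a ⊏ c
  ⊏-≼-trans p (inj₁ refl) = p
  ⊏-≼-trans p (inj₂ q) = ⊏-trans p q

  ≼∧≢⇒⊏ : ∀ {a b} → a ≼ b → b ≢ a → a ⊏ b
  ≼∧≢⇒⊏ (inj₁ refl) ne = ⊥-elim (ne refl)
  ≼∧≢⇒⊏ (inj₂ p) _ = p

  ≼-lastOf : ∀ {a t ms z} → Walk arc a t ms → z ∈ a ∷ ms → z ≼ lastOf a ms
  ≼-lastOf (edge e) (here refl) = inj₁ refl
  ≼-lastOf (step e w) (here refl) = ≼-trans (inj₂ (⊏-arc e)) (≼-lastOf w (here refl))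
  ≼-lastOf (step e w) (there m) = ≼-lastOf w m

  parentExists : ∀ v → v ≢ root → Σ (Fin n) λ u → Arc u v
  parentExists v nr with indeg arc v in eq
  ... | zero = ⊥-elim (nr (root-unique v eq))
  ... | suc k = count-witness n (λ u → arc u v)
                  (subst (1 ≤_) (trans (sym eq) (indeg≡count arc v)) (s≤s z≤n))

  rootReaches : ∀ v → v ≡ root ⊎ root ⊏ v
  rootReaches v = go v (spo-wellFounded ⊏-isStrictPartialOrder v)
    where
      go : ∀ v → Acc _⊏_ v → v ≡ root ⊎ root ⊏ v
      go v (acc rs) with v ≟ root
      ... | yes e = inj₁ e
      ... | no nr with parentExists v nr
      ...   | u , e with go u (rs (⊏-arc e))
      ...     | inj₁ refl = inj₂ ([] , edge e)
      ...     | inj₂ (ms , w) = inj₂ (_ , (w ++ʷ edge e))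

  rootPathVia : ∀ {u t} → Arc u t → Σ (List (Fin n)) λ ms → Walk arc root t ms × lastOf root ms ≡ u
  rootPathVia {u} e with rootReaches u
  ... | inj₁ refl = [] , edge e , refl
  ... | inj₂ (ms , w) = ms ++ u ∷ [] , (w ++ʷ edge e) , lastOf-++ root ms u []

  rootPathThrough : ∀ {v t ms} → Walk arc v t ms →
                    Σ (List (Fin n)) λ L → Σ (List (Fin n)) λ ms' →
                      Walk arc root t ms' × root ∷ ms' ≡ L ++ v ∷ ms
  rootPathThrough {v} {t} {ms} w with rootReaches v
  ... | inj₁ refl = [] , ms , w , refl
  ... | inj₂ (ms₀ , w₀) = root ∷ ms₀ , ms₀ ++ v ∷ ms , (w₀ ++ʷ w) , refl

-- 5. Undirected connectivity along paths

module Connectivity (N : Network) where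
  open NetworkFacts N

  conn-start : ∀ {P A u v} → UConn N P A u v → P u
  conn-start (UConn.here p) = p
  conn-start (UConn.there p _ _) = p

  conn-end : ∀ {P A u v} → UConn N P A u v → P v
  conn-end (UConn.here p) = p
  conn-end (UConn.there _ _ c) = conn-end c

  conn-trans : ∀ {P A u v w} → UConn N P A u v → UConn N P A v w → UConn N P A u w
  conn-trans (UConn.here p) c = c
  conn-trans (UConn.there p a c) c' = UConn.there p a (conn-trans c c')

  conn-back : ∀ {P : Fin n → Set} {A : Fin n → Fin n → Set} {u v} → P u → P v → A v u → UConn N P A u v
  conn-back pu pv a = UConn.there pu (inj₂ a) (UConn.here pv)

  conn-sym : ∀ {P A u v} → UConn N P A u v → UConn N P A v u
  conn-sym (UConn.here p) = UConn.here p
  conn-sym (UConn.there p (inj₁ a) c) = conn-trans (conn-sym c) (conn-back (conn-start c) p a)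
  conn-sym (UConn.there p (inj₂ a) c) =
    conn-trans (conn-sym c) (UConn.there (conn-start c) (inj₁ a) (UConn.here p))

  conn-mono : ∀ {P P' : Fin n → Set} {A A' : Fin n → Fin n → Set} →
              (∀ w → P w → P' w) → (∀ u v → A u v → A' u v) → ∀ {u v} → UConn N P A u v → UConn N P' A' u v
  conn-mono f g (UConn.here p) = UConn.here (f _ p)
  conn-mono f g (UConn.there p (inj₁ a) c) = UConn.there (f _ p) (inj₁ (g _ _ a)) (conn-mono f g c)
  conn-mono f g (UConn.there p (inj₂ a) c) = UConn.there (f _ p) (inj₂ (g _ _ a)) (conn-mono f g c)

  crossConn : ∀ {P : Fin n → Set} {A : Fin n → Fin n → Set} (R : Fin n → Set) {u v} →
              UConn N P A u v → R u → ¬ R v →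
              (∀ y y' → P y → P y' → (A y y' ⊎ A y' y) → R y → ¬ R y' → ⊥) → ⊥
  crossConn R (UConn.here p) ru nrv k = nrv ru
  crossConn R (UConn.there p a c) ru nrv k =
    refuteByCases (λ rw → crossConn R c rw nrv k) (λ nrw → k _ _ p (conn-start c) a ru nrw)

  entersDescendants : ∀ {P : Fin n → Set} {A : Fin n → Fin n → Set} r → (∀ u v → A u v → Arc u v) →
                      ∀ {u v} → UConn N P A u v → r ≼ u → ¬ r ≼ v →
                      (∀ y y' → P y → P y' → Arc y' y → r ≼ y → ¬ r ≼ y' → ⊥) → ⊥
  entersDescendants r A⊆arc c ru nrv k = crossConn (r ≼_) c ru nrv cross
    where
      cross : ∀ y y' → _ → _ → _ → r ≼ y → ¬ r ≼ y' → ⊥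
      cross y y' py py' (inj₁ a) ry nry' = nry' (≼-arc ry (A⊆arc _ _ a))
      cross y y' py py' (inj₂ a) ry nry' = k y y' py py' (A⊆arc _ _ a) ry nry'

  OnPath : Fin n → Fin n → List (Fin n) → Fin n → Set
  OnPath a t ms u = u ≡ a ⊎ u ≡ t ⊎ u ∈ ms

  private
    onRest : ∀ {z t ms u} → u ≡ t ⊎ u ∈ z ∷ ms → OnPath z t ms u
    onRest (inj₁ e) = inj₂ (inj₁ e)
    onRest (inj₂ (here e)) = inj₁ e
    onRest (inj₂ (there m)) = inj₂ (inj₂ m)

    onLater : ∀ {a z t ms u} → OnPath z t ms u → OnPath a t (z ∷ ms) u
    onLater (inj₁ e) = inj₂ (inj₂ (here e))
    onLater (inj₂ (inj₁ e)) = inj₂ (inj₁ e)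
    onLater (inj₂ (inj₂ m)) = inj₂ (inj₂ (there m))

  module _ {P : Fin n → Set} {A : Fin n → Fin n → Set} where

    path-connected : ∀ {a t ms} (w : Walk arc a t ms) → (∀ u v → (u , v) ∈ walkArcs w → A u v) →
                     (∀ y → OnPath a t ms y → P y) → ∀ u → OnPath a t ms u → UConn N P A u a
    path-connected w arcs nodes u (inj₁ refl) = UConn.here (nodes u (inj₁ refl))
    path-connected (edge e) arcs nodes u (inj₂ (inj₁ refl)) =
      conn-back (nodes u (inj₂ (inj₁ refl))) (nodes _ (inj₁ refl)) (arcs _ _ (here refl))
    path-connected (step e w) arcs nodes u (inj₂ o) =
      conn-trans (path-connected w (λ u v m → arcs u v (there m)) (λ y o' → nodes y (onLater o')) u (onRest o))
                 (conn-back (nodes _ (onLater (inj₁ refl))) (nodes _ (inj₁ refl)) (arcs _ _ (here refl)))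

    path-minus-connected : ∀ {a t ms} x (w : Walk arc a t ms) → (∀ u v → (u , v) ∈ walkArcs w → A u v) →
                           (∀ y → OnPath a t ms y → y ≢ x → P y) →
                           ∀ u → OnPath a t ms u → u ≢ x → UConn N P A u a ⊎ UConn N P A u t
    path-minus-connected x w arcs nodes u (inj₁ refl) ux = inj₁ (UConn.here (nodes u (inj₁ refl) ux))
    path-minus-connected x w arcs nodes u (inj₂ (inj₁ refl)) ux =
      inj₂ (UConn.here (nodes u (inj₂ (inj₁ refl)) ux))
    path-minus-connected {a} x (step {z = z} e w) arcs nodes u (inj₂ (inj₂ m)) ux with x ≟ a
    ... | yes refl = inj₂ (conn-trans (toZ u (onRest (inj₂ m))) (conn-sym (toZ _ (inj₂ (inj₁ refl)))))
      where
        avoidsX : ∀ y → OnPath z _ _ y → y ≢ x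
        avoidsX y (inj₁ refl) refl = ⊏-irrefl (⊏-arc e)
        avoidsX y (inj₂ (inj₁ refl)) refl = start≢end (step e w) refl
        avoidsX y (inj₂ (inj₂ m)) refl = start∉ (step e w) (there m)
        toZ : ∀ u → OnPath z _ _ u → UConn N P A u z
        toZ = path-connected w (λ u v m → arcs u v (there m)) (λ y o → nodes y (onLater o) (avoidsX y o))
    ... | no ax with path-minus-connected x w (λ u v m → arcs u v (there m)) (λ y o → nodes y (onLater o))
                                         u (onRest (inj₂ m)) ux
    ...   | inj₂ c = inj₂ c
    ...   | inj₁ c =
      inj₁ (conn-trans c (conn-back (conn-end c) (nodes _ (inj₁ refl) (λ e → ax (sym e))) (arcs _ _ (here refl))))

-- 6. Degree constraints in a binary network

module BinaryNetwork (N : Network) (bin : Binary N) where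
  open NetworkFacts N public
  open Connectivity N public
  open RetCycle public
  open import Data.List.Membership.DecPropositional (_≟_ {n = n}) using (_∈?_)

  indeg-hybrid : ∀ {v} → Hybrid N v → count n (λ u → arc u v) ≡ 2
  indeg-hybrid {v} h = trans (sym (indeg≡count arc v)) (proj₁ (proj₁ (bin v) h))

  outdeg-hybrid : ∀ {v} → Hybrid N v → count n (λ w → arc v w) ≡ 1
  outdeg-hybrid {v} h = trans (sym (outdeg≡count arc v)) (proj₂ (proj₁ (bin v) h))

  twoParents⇒hybrid : ∀ {a b v} → Arc a v → Arc b v → a ≢ b → Hybrid N v
  twoParents⇒hybrid {a} {b} {v} ea eb ne =
    subst (2 ≤_) (sym (indeg≡count arc v)) (count-≥2 n (λ u → arc u v) a b ne ea eb)

  hybrid-twoParents : ∀ {v} → Hybrid N v → Σ (Fin n) λ a → Σ (Fin n) λ b → a ≢ b × Arc a v × Arc b v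
  hybrid-twoParents {v} h = count-witness₂ n (λ u → arc u v) (subst (2 ≤_) (indeg≡count arc v) h)

  hybrid-parents : ∀ {a b v x} → Hybrid N v → Arc a v → Arc b v → a ≢ b → Arc x v → x ≡ a ⊎ x ≡ b
  hybrid-parents {a} {b} {v} {x} h ea eb ne ex with x ≟ a | x ≟ b
  ... | yes p | _ = inj₁ p
  ... | no _ | yes q = inj₂ q
  ... | no p | no q = ⊥-elim (<-irrefl refl (≤-trans three (≤-reflexive (indeg-hybrid h))))
    where three = count-≥3 n (λ u → arc u v) a b x ne (λ e → p (sym e)) (λ e → q (sym e)) ea eb ex

  hybrid-child-unique : ∀ {a b v} → Hybrid N v → Arc v a → Arc v b → a ≡ b
  hybrid-child-unique {a} {b} {v} h ea eb with a ≟ b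
  ... | yes p = p
  ... | no p = ⊥-elim (<-irrefl refl (≤-trans (count-≥2 n (λ w → arc v w) a b p ea eb)
                                              (≤-reflexive (outdeg-hybrid h))))

  treeNode-parent-unique : ∀ {a b v} → ¬ Hybrid N v → Arc a v → Arc b v → a ≡ b
  treeNode-parent-unique nh ea eb with _ ≟ _
  ... | yes p = p
  ... | no p = ⊥-elim (nh (twoParents⇒hybrid ea eb p))

  twoChildren⇒¬hybrid : ∀ {a b v} → Arc v a → Arc v b → a ≢ b → ¬ Hybrid N v
  twoChildren⇒¬hybrid ea eb ne h = ne (hybrid-child-unique h ea eb)

  twoChildren-only : ∀ {a b v x} → Arc v a → Arc v b → a ≢ b → Arc v x → x ≡ a ⊎ x ≡ b
  twoChildren-only {a} {b} {v} {x} ea eb ne ex with x ≟ a | x ≟ b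
  ... | yes p | _ = inj₁ p
  ... | no _ | yes q = inj₂ q
  ... | no p | no q = ⊥-elim (<-irrefl refl (≤-trans three (≤-reflexive outdeg≡2)))
    where
      three = count-≥3 n (λ w → arc v w) a b x ne (λ e → p (sym e)) (λ e → q (sym e)) ea eb ex
      two = count-≥2 n (λ w → arc v w) a b ne ea eb
      tree : TreeNode N v
      tree with indeg arc v ≤? 1
      ... | yes le = le
      ... | no nle = ⊥-elim (twoChildren⇒¬hybrid ea eb ne (≰⇒> nle))
      nonLeaf : ¬ outdeg arc v ≡ 0
      nonLeaf e with subst (2 ≤_) (trans (sym (outdeg≡count arc v)) e) two
      ... | ()
      outdeg≡2 : count n (λ w → arc v w) ≡ 2
      outdeg≡2 = trans (sym (outdeg≡count arc v)) (proj₂ (bin v) tree nonLeaf)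

  -- 7. Anatomy of a reticulation cycle; cycles sharing a node share an arc

  Cycle : Set
  Cycle = RetCycle N

  last₁ last₂ first₁ first₂ : Cycle → Fin n
  last₁ C = lastOf (split C) (int₁ C)
  last₂ C = lastOf (split C) (int₂ C)
  first₁ C = headOr (end C) (int₁ C)
  first₂ C = headOr (end C) (int₂ C)

  lasts-distinct : ∀ (C : Cycle) → last₁ C ≢ last₂ C
  lasts-distinct C e with lastOf-∈ (split C) (int₁ C) | lastOf-∈ (split C) (int₂ C)
  ... | inj₁ a | inj₁ b = distinctPaths C (trans (lastOf-[] _ _ a (start∉ (path₁ C)))
                                                 (sym (lastOf-[] _ _ b (start∉ (path₂ C)))))
  ... | inj₁ a | inj₂ b = start∉ (path₂ C) (subst (_∈ int₂ C) (trans (sym e) a) b)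
  ... | inj₂ a | inj₁ b = start∉ (path₁ C) (subst (_∈ int₁ C) (trans e b) a)
  ... | inj₂ a | inj₂ b = noCommonInt C _ a (subst (_∈ int₂ C) (sym e) b)

  firsts-distinct : ∀ (C : Cycle) → first₁ C ≢ first₂ C
  firsts-distinct C e with int₁ C | int₂ C | distinctPaths C | noCommonInt C | path₁ C | path₂ C
  ... | [] | [] | d | _ | _ | _ = d refl
  ... | [] | x ∷ I | _ | _ | _ | p₂ = end∉ p₂ (here e)
  ... | x ∷ I | [] | _ | _ | p₁ | _ = end∉ p₁ (here (sym e))
  ... | x ∷ I | y ∷ J | _ | nc | _ | _ = nc x (here refl) (here e)

  end-hybrid : ∀ (C : Cycle) → Hybrid N (end C)
  end-hybrid C = twoParents⇒hybrid (lastArc (path₁ C)) (lastArc (path₂ C)) (lasts-distinct C)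

  end-parents : ∀ (C : Cycle) {x} → Arc x (end C) → x ≡ last₁ C ⊎ x ≡ last₂ C
  end-parents C = hybrid-parents (end-hybrid C) (lastArc (path₁ C)) (lastArc (path₂ C)) (lasts-distinct C)

  split-children : ∀ (C : Cycle) {x} → Arc (split C) x → x ≡ first₁ C ⊎ x ≡ first₂ C
  split-children C = twoChildren-only (firstArc (path₁ C)) (firstArc (path₂ C)) (firsts-distinct C)

  split-¬hybrid : ∀ (C : Cycle) → ¬ Hybrid N (split C)
  split-¬hybrid C = twoChildren⇒¬hybrid (firstArc (path₁ C)) (firstArc (path₂ C)) (firsts-distinct C)

  swap : Cycle → Cycle
  swap C = record { split = split C ; end = end C ; int₁ = int₂ C ; int₂ = int₁ C
                  ; path₁ = path₂ C ; path₂ = path₁ C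
                  ; distinctPaths = λ e → distinctPaths C (sym e)
                  ; noCommonInt = λ x a b → noCommonInt C x b a }

  differentEnds : ∀ (C D : Cycle) → end C ≢ end D → ¬ SameCycle N C D
  differentEnds C D ne same = ne (proj₁ (proj₂ same))

  SameCycle-int₁ : ∀ {C D : Cycle} {z} → SameCycle N C D → z ∈ int₁ C → z ∈ cycleNodes N D
  SameCycle-int₁ (_ , _ , inj₁ (e , _)) m = there (there (∈-++⁺ˡ (subst (_ ∈_) e m)))
  SameCycle-int₁ {D = D} (_ , _ , inj₂ (e , _)) m = there (there (∈-++⁺ʳ (int₁ D) (subst (_ ∈_) e m)))

  split≢end : ∀ (C : Cycle) → split C ≢ end C
  split≢end C = start≢end (path₁ C)

  onInt₁ : ∀ (C : Cycle) {y} → y ∈ int₁ C → y ∈ intermediates N C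
  onInt₁ C m = ∈-++⁺ˡ m

  onInt₂ : ∀ (C : Cycle) {y} → y ∈ int₂ C → y ∈ intermediates N C
  onInt₂ C m = ∈-++⁺ʳ (int₁ C) m

  intermediate-onCycle : ∀ (C : Cycle) {x} → x ∈ intermediates N C → x ∈ cycleNodes N C
  intermediate-onCycle C m = there (there m)

  intermediate-exists : ∀ (C : Cycle) → Σ (Fin n) λ x → x ∈ intermediates N C
  intermediate-exists C = nonEmpty (intermediates N C) λ e →
    distinctPaths C (trans (++-conicalˡ (int₁ C) (int₂ C) e) (sym (++-conicalʳ (int₁ C) (int₂ C) e)))

  end-onCycle : ∀ (C : Cycle) → end C ∈ cycleNodes N C
  end-onCycle C = there (here refl)

  intermediate≢end : ∀ (C : Cycle) {x} → x ∈ intermediates N C → x ≢ end C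
  intermediate≢end C m refl with ∈-++⁻ (int₁ C) m
  ... | inj₁ a = end∉ (path₁ C) a
  ... | inj₂ b = end∉ (path₂ C) b

  intermediate≢split : ∀ (C : Cycle) {x} → x ∈ intermediates N C → x ≢ split C
  intermediate≢split C m refl with ∈-++⁻ (int₁ C) m
  ... | inj₁ a = start∉ (path₁ C) a
  ... | inj₂ b = start∉ (path₂ C) b

  first₁-onCycle : ∀ (C : Cycle) → first₁ C ∈ cycleNodes N C
  first₁-onCycle C with headOr-∈ (end C) (int₁ C)
  ... | inj₁ e = there (here e)
  ... | inj₂ m = intermediate-onCycle C (onInt₁ C m)

  first₂-onCycle : ∀ (C : Cycle) → first₂ C ∈ cycleNodes N C
  first₂-onCycle C with headOr-∈ (end C) (int₂ C)
  ... | inj₁ e = there (here e)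
  ... | inj₂ m = intermediate-onCycle C (onInt₂ C m)

  onArcs₁ : ∀ (C : Cycle) {a} → a ∈ walkArcs (path₁ C) → a ∈ cycleArcs N C
  onArcs₁ C m = ∈-++⁺ˡ m

  onArcs₂ : ∀ (C : Cycle) {a} → a ∈ walkArcs (path₂ C) → a ∈ cycleArcs N C
  onArcs₂ C m = ∈-++⁺ʳ (walkArcs (path₁ C)) m

  cycleArc-isArc : ∀ (C : Cycle) {u v} → (u , v) ∈ cycleArcs N C → Arc u v
  cycleArc-isArc C m with ∈-++⁻ (walkArcs (path₁ C)) m
  ... | inj₁ a = walkArc (path₁ C) a
  ... | inj₂ b = walkArc (path₂ C) b

  cycleArc-source : ∀ (C : Cycle) {u v} → (u , v) ∈ cycleArcs N C → u ∈ cycleNodes N C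
  cycleArc-source C m with ∈-++⁻ (walkArcs (path₁ C)) m
  ... | inj₁ a with arcSource (path₁ C) a
  ...   | inj₁ refl = here refl
  ...   | inj₂ i = intermediate-onCycle C (onInt₁ C i)
  cycleArc-source C m | inj₂ b with arcSource (path₂ C) b
  ...   | inj₁ refl = here refl
  ...   | inj₂ i = intermediate-onCycle C (onInt₂ C i)

  cycleArc-target : ∀ (C : Cycle) {u v} → (u , v) ∈ cycleArcs N C → v ≡ end C ⊎ v ∈ intermediates N C
  cycleArc-target C m with ∈-++⁻ (walkArcs (path₁ C)) m
  ... | inj₁ a with arcTarget (path₁ C) a
  ...   | inj₁ e = inj₁ e
  ...   | inj₂ i = inj₂ (onInt₁ C i)
  cycleArc-target C m | inj₂ b with arcTarget (path₂ C) b
  ...   | inj₁ e = inj₁ e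
  ...   | inj₂ i = inj₂ (onInt₂ C i)

  cycleArc-targetNode : ∀ (C : Cycle) {u v} → (u , v) ∈ cycleArcs N C → v ∈ cycleNodes N C
  cycleArc-targetNode C m with cycleArc-target C m
  ... | inj₁ e = there (here e)
  ... | inj₂ i = intermediate-onCycle C i

  split-outArc : ∀ (C : Cycle) {x s} → x ≡ split C → Arc x s → (x , s) ∈ cycleArcs N C
  split-outArc C refl e with split-children C e
  ... | inj₁ refl = onArcs₁ C (firstArc∈ (path₁ C))
  ... | inj₂ refl = onArcs₂ C (firstArc∈ (path₂ C))

  end-inArc : ∀ (C : Cycle) {x p} → x ≡ end C → Arc p x → (p , x) ∈ cycleArcs N C
  end-inArc C refl e with end-parents C e
  ... | inj₁ refl = onArcs₁ C (lastArc∈ (path₁ C))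
  ... | inj₂ refl = onArcs₂ C (lastArc∈ (path₂ C))

  InArc OutArc : Cycle → Fin n → Set
  InArc C x = Σ (Fin n) λ p → (p , x) ∈ cycleArcs N C
  OutArc C x = Σ (Fin n) λ s → (x , s) ∈ cycleArcs N C

  Role : Cycle → Fin n → Set
  Role C x = x ≡ split C ⊎ x ≡ end C ⊎ (InArc C x × OutArc C x)

  innerRole : ∀ (C : Cycle) {ms} (w : Walk arc (split C) (end C) ms) →
              (∀ {a} → a ∈ walkArcs w → a ∈ cycleArcs N C) → ∀ {x} → x ∈ ms → InArc C x × OutArc C x
  innerRole C w sub m with incomingArc w m | outgoingArc w m
  ... | p , pm | s , sm = (p , sub pm) , (s , sub sm)

  role : ∀ (C : Cycle) {x} → x ∈ cycleNodes N C → Role C x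
  role C (here e) = inj₁ e
  role C (there (here e)) = inj₂ (inj₁ e)
  role C (there (there m)) with ∈-++⁻ (int₁ C) m
  ... | inj₁ a = inj₂ (inj₂ (innerRole C (path₁ C) (onArcs₁ C) a))
  ... | inj₂ b = inj₂ (inj₂ (innerRole C (path₂ C) (onArcs₂ C) b))

  split-outArcOf : ∀ (C : Cycle) {x} → x ≡ split C → OutArc C x
  split-outArcOf C refl = _ , onArcs₁ C (firstArc∈ (path₁ C))

  end-inArcOf : ∀ (C : Cycle) {x} → x ≡ end C → InArc C x
  end-inArcOf C refl = _ , onArcs₁ C (lastArc∈ (path₁ C))

  -- a split is never an end, since ends are hybrid and splits are not
  split≢otherEnd : ∀ (C D : Cycle) → split C ≢ end D
  split≢otherEnd C D e = split-¬hybrid C (subst (Hybrid N) (sym e) (end-hybrid D))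

  SharedArc : Cycle → Cycle → Set
  SharedArc C D = Σ (Fin n × Fin n) λ a → a ∈ cycleArcs N C × a ∈ cycleArcs N D

  -- At a split (end) all outgoing (incoming)
  -- arcs belong to the cycle; at two inner positions, either the
  -- entering arcs agree or the node is hybrid and its unique outgoing
  -- arc is shared.
  sharedArc : ∀ (C D : Cycle) {x} → Role C x → Role D x → SharedArc C D
  sharedArc C D (inj₁ sC) (inj₁ sD) with split-outArcOf D sD
  ... | s , m = _ , split-outArc C sC (cycleArc-isArc D m) , m
  sharedArc C D (inj₁ sC) (inj₂ (inj₁ eD)) = ⊥-elim (split≢otherEnd C D (trans (sym sC) eD))
  sharedArc C D (inj₁ sC) (inj₂ (inj₂ (_ , (s , m)))) = _ , split-outArc C sC (cycleArc-isArc D m) , m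
  sharedArc C D (inj₂ (inj₁ eC)) (inj₁ sD) = ⊥-elim (split≢otherEnd D C (trans (sym sD) eC))
  sharedArc C D (inj₂ (inj₁ eC)) (inj₂ (inj₁ eD)) with end-inArcOf D eD
  ... | p , m = _ , end-inArc C eC (cycleArc-isArc D m) , m
  sharedArc C D (inj₂ (inj₁ eC)) (inj₂ (inj₂ ((p , m) , _))) = _ , end-inArc C eC (cycleArc-isArc D m) , m
  sharedArc C D (inj₂ (inj₂ (_ , (s , m)))) (inj₁ sD) = _ , m , split-outArc D sD (cycleArc-isArc C m)
  sharedArc C D (inj₂ (inj₂ ((p , m) , _))) (inj₂ (inj₁ eD)) = _ , m , end-inArc D eD (cycleArc-isArc C m)
  sharedArc C D (inj₂ (inj₂ ((p , mp) , (s , ms)))) (inj₂ (inj₂ ((p' , mp') , (s' , ms')))) with p ≟ p'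
  ... | yes refl = _ , mp , mp'
  ... | no ne with hybrid-child-unique (twoParents⇒hybrid (cycleArc-isArc C mp) (cycleArc-isArc D mp') ne)
                                      (cycleArc-isArc C ms) (cycleArc-isArc D ms')
  ...   | refl = _ , ms , ms'

  sharedNode⇒sharedArc : ∀ (C D : Cycle) {x} → x ∈ cycleNodes N C → x ∈ cycleNodes N D → SharedArc C D
  sharedNode⇒sharedArc C D a b = sharedArc C D (role C a) (role D b)

  GT⇒WGT : GalledTree N → WeaklyGalledTree N
  GT⇒WGT gt C D ns (u , v) a b = gt C D ns u (cycleArc-source C a) (cycleArc-source D b)

  WGT⇒GT : WeaklyGalledTree N → GalledTree N
  WGT⇒GT wg C D ns x a b with sharedNode⇒sharedArc C D a b
  ... | ar , m₁ , m₂ = wg C D ns ar m₁ m₂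

  WGT⇒ON : WeaklyGalledTree N → OneNested N
  WGT⇒ON wg C D ne x a b
    with sharedNode⇒sharedArc C D (intermediate-onCycle C a) (intermediate-onCycle D b)
  ... | ar , m₁ , m₂ = wg C D (differentEnds C D ne) ar m₁ m₂

  -- 8. Extracting reticulation cycles; every hybrid node ends a cycle

  -- Two paths from r to t entering t through different arcs contain a
  -- cycle ending at t: its split is the last node of the first path that
  -- also lies on the second, and its paths are the two remaining suffixes.
  record Confluence (r t : Fin n) (ms₁ ms₂ : List (Fin n)) : Set where
    field
      cyc : Cycle
      endEq : end cyc ≡ t
      prefix : List (Fin n)
      position : r ∷ ms₁ ≡ prefix ++ split cyc ∷ int₁ cyc
      split∈ : split cyc ∈ r ∷ ms₂

  confluence : ∀ {r t ms₁ ms₂} → Walk arc r t ms₁ → Walk arc r t ms₂ →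
               lastOf r ms₁ ≢ lastOf r ms₂ → Confluence r t ms₁ ms₂
  confluence {r} {t} {ms₁} {ms₂} w₁ w₂ ld with lastMember (r ∷ ms₂) (r ∷ ms₁)
  ... | inj₂ avoids = ⊥-elim (avoids r (here refl) (here refl))
  ... | inj₁ (pre , x , I , eq , xM , nI) with ∈-∃++ xM
  ...   | pre₂ , I₂ , eq₂ =
          record { cyc = D ; endEq = refl ; prefix = pre ; position = eq ; split∈ = xM }
    where
      D : Cycle
      D = record
        { split = x ; end = t ; int₁ = I ; int₂ = I₂
        ; path₁ = suffixWalk pre x I w₁ eq
        ; path₂ = suffixWalk pre₂ x I₂ w₂ eq₂
        ; distinctPaths = λ e → ld (trans (lastOf-split pre x I eq)
                                  (trans (cong (lastOf x) e) (sym (lastOf-split pre₂ x I₂ eq₂))))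
        ; noCommonInt = λ y a b → nI y a (there (suffix-∈ pre₂ x I₂ eq₂ b)) }

  record CycleThrough (R : Fin n → Set) (v t : Fin n) (ms : List (Fin n)) : Set where
    field
      cyc : Cycle
      endEq : end cyc ≡ t
      covers : ∀ z → z ∈ v ∷ ms → z ∈ split cyc ∷ int₁ cyc
      split-¬R : ¬ R (split cyc)

  cycleThrough : ∀ {v t ms y} → Walk arc v t ms → Arc y t → lastOf v ms ≢ y →
                 (R : Fin n → Set) → (∀ z → z ≼ y → ¬ R z) → (∀ z → z ∈ ms → R z) →
                 CycleThrough R v t ms
  cycleThrough {v} {t} {ms} {y} wv e ne R ¬R-above-y R-on-path
    with rootPathThrough wv | rootPathVia e
  ... | L , ms' , w₁ , eq | ms₂ , w₂ , lastIsY = record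
        { cyc = D ; endEq = Confluence.endEq X ; covers = covers ; split-¬R = split-¬R }
    where
      X = confluence w₁ w₂ (λ q → ne (trans (sym (lastOf-split L v ms eq)) (trans q lastIsY)))
      D = Confluence.cyc X
      split-¬R : ¬ R (split D)
      split-¬R = ¬R-above-y _ (subst (split D ≼_) lastIsY (≼-lastOf w₂ (Confluence.split∈ X)))
      covers : ∀ z → z ∈ v ∷ ms → z ∈ split D ∷ int₁ D
      covers = suffix-⊆ (Confluence.prefix X) L (split D) v (int₁ D) ms
                        (trans (sym (Confluence.position X)) eq) (λ m → split-¬R (R-on-path _ m))

  cycleThrough-onCycle : ∀ {R v t ms} (X : CycleThrough R v t ms) → v ∈ cycleNodes N (CycleThrough.cyc X)
  cycleThrough-onCycle X with CycleThrough.covers X _ (here refl)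
  ... | here e = here e
  ... | there m = intermediate-onCycle (CycleThrough.cyc X) (onInt₁ (CycleThrough.cyc X) m)

  hybrid-isEnd : ∀ {g} → Hybrid N g → Σ Cycle λ D → end D ≡ g
  hybrid-isEnd h with hybrid-twoParents h
  ... | a , b , ne , ea , eb = CycleThrough.cyc X , CycleThrough.endEq X
    where X = cycleThrough (edge ea) eb ne (λ _ → ⊥) (λ _ _ ()) (λ _ ())

  -- 9. In a 1-nested network cycle ends are never intermediate, and
  --    two distinct cycles share no node

  module OneNestedFacts (oneNested : OneNested N) where

    -- Setting: the end g of C₁ is an intermediate node of the first path
    -- of C₂ (split s₂, end h₂), which enters g from the node x.
    module EndOnPath (C₁ C₂ : Cycle) (A B : List (Fin n)) (eqI : int₁ C₂ ≡ A ++ end C₁ ∷ B)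
                     (wA : Walk arc (split C₂) (end C₁) A) (wB : Walk arc (end C₁) (end C₂) B) where
      g = end C₁
      x = lastOf (split C₂) A

      g∈int₁ : g ∈ int₁ C₂
      g∈int₁ = subst (g ∈_) (sym eqI) (∈-++⁺ʳ A (here refl))

      A⊆int₁ : ∀ {y} → y ∈ A → y ∈ int₁ C₂
      A⊆int₁ m = subst (_ ∈_) (sym eqI) (∈-++⁺ˡ m)

      B⊆int₁ : ∀ {y} → y ∈ B → y ∈ int₁ C₂
      B⊆int₁ m = subst (_ ∈_) (sym eqI) (∈-++⁺ʳ A (there m))

      g≢h₂ : g ≢ end C₂
      g≢h₂ e = end∉ (path₁ C₂) (subst (_∈ int₁ C₂) e g∈int₁)

      g∉int₂ : g ∉ int₂ C₂
      g∉int₂ = noCommonInt C₂ g g∈int₁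

      int₂-disjoint : ∀ {y} → y ∈ int₂ C₁ → y ∈ int₂ C₂ → ⊥
      int₂-disjoint a b = oneNested C₁ C₂ g≢h₂ _ (onInt₂ C₁ a) (onInt₂ C₂ b)

      -- If C₁'s first path is a single arc (so x is the split of C₁), the
      -- detour x ⇝ g along C₁'s second path gives a cycle ending at h₂
      -- that shares an intermediate node with C₁.
      detourAtSplit : int₁ C₁ ≡ [] → split C₁ ≡ x → ⊥
      detourAtSplit noInner s₁≡x with nonEmpty (int₂ C₁) (λ e → distinctPaths C₁ (trans noInner (sym e)))
      ... | y , y∈J = oneNested C₁ C₂' g≢h₂ y (onInt₂ C₁ y∈J) (∈-++⁺ˡ (∈-++⁺ʳ A (∈-++⁺ˡ y∈J)))
        where
          J = int₂ C₁
          disjoint : ∀ z → z ∈ A ++ (J ++ g ∷ B) → z ∉ int₂ C₂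
          disjoint z m zM with ∈-++⁻ A m
          ... | inj₁ a = noCommonInt C₂ z (A⊆int₁ a) zM
          ... | inj₂ m' with ∈-++⁻ J m'
          ...   | inj₁ j = int₂-disjoint j zM
          ...   | inj₂ (here refl) = g∉int₂ zM
          ...   | inj₂ (there b) = noCommonInt C₂ z (B⊆int₁ b) zM
          C₂' : Cycle
          C₂' = record
            { split = split C₂ ; end = end C₂ ; int₁ = A ++ (J ++ g ∷ B) ; int₂ = int₂ C₂
            ; path₁ = replaceLast wA (subst (λ z → Walk arc z (end C₂) (J ++ g ∷ B)) s₁≡x (path₂ C₁ ++ʷ wB))
            ; path₂ = path₂ C₂
            ; distinctPaths = λ e → g∉int₂ (subst (g ∈_) e (∈-++⁺ʳ A (∈-++⁺ʳ J (here refl))))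
            ; noCommonInt = disjoint }

      -- If x is the split of C₂ and inner on C₁'s first path, rerouting C₁
      -- at x along C₂'s second path gives a cycle ending at h₂ through x.
      rerouteAtSplit : x ∈ int₁ C₁ → last₁ C₁ ≡ split C₂ → ⊥
      rerouteAtSplit x∈I₁ l₁≡s₂ = oneNested C₁ C₂' g≢h₂ _ (onInt₁ C₁ x∈I₁) (∈-++⁺ʳ (J ++ g ∷ B) (∈-++⁺ˡ x∈I₁))
        where
          J = int₂ C₁
          I₁ = int₁ C₁
          M = int₂ C₂
          disjoint : ∀ z → z ∈ J ++ g ∷ B → z ∉ I₁ ++ M
          disjoint z m m₂ with ∈-++⁻ J m | ∈-++⁻ I₁ m₂
          ... | inj₁ j | inj₁ i = noCommonInt C₁ z i j
          ... | inj₁ j | inj₂ k = int₂-disjoint j k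
          ... | inj₂ (here refl) | inj₁ i = end∉ (path₁ C₁) i
          ... | inj₂ (here refl) | inj₂ k = g∉int₂ k
          ... | inj₂ (there b) | inj₁ i = ⊏-asym (from-intermediate wB b) (to-intermediate (path₁ C₁) i)
          ... | inj₂ (there b) | inj₂ k = noCommonInt C₂ z (B⊆int₁ b) k
          C₂' : Cycle
          C₂' = record
            { split = split C₁ ; end = end C₂ ; int₁ = J ++ g ∷ B ; int₂ = I₁ ++ M
            ; path₁ = path₂ C₁ ++ʷ wB
            ; path₂ = replaceLast (path₁ C₁) (subst (λ z → Walk arc z (end C₂) M) (sym l₁≡s₂) (path₂ C₂))
            ; distinctPaths = λ e → disjoint g (∈-++⁺ʳ J (here refl)) (subst (g ∈_) e (∈-++⁺ʳ J (here refl)))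
            ; noCommonInt = disjoint }

      notLast₁ : x ≡ last₁ C₁ → ⊥
      notLast₁ xe with lastOf-∈ (split C₁) (int₁ C₁)
      ... | inj₁ e = detourAtSplit (lastOf-[] _ _ e (start∉ (path₁ C₁))) (trans (sym e) (sym xe))
      ... | inj₂ x∈I₁ with lastOf-∈ (split C₂) A
      ...   | inj₂ x∈A = oneNested C₁ C₂ g≢h₂ _ (onInt₁ C₁ (subst (_∈ int₁ C₁) (sym xe) x∈I₁))
                                               (onInt₁ C₂ (A⊆int₁ x∈A))
      ...   | inj₁ x≡s₂ = rerouteAtSplit (subst (_∈ int₁ C₁) (sym xe) x∈I₁) (trans (sym xe) x≡s₂)

    end-notOnFirstPath : ∀ (C₁ C₂ : Cycle) → end C₁ ∈ int₁ C₂ → ⊥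
    end-notOnFirstPath C₁ C₂ m with splitWalk (path₁ C₂) m
    ... | A , B , eqI , wA , wB with end-parents C₁ (lastArc wA)
    ...   | inj₁ e = EndOnPath.notLast₁ C₁ C₂ A B eqI wA wB e
    ...   | inj₂ e = EndOnPath.notLast₁ (swap C₁) C₂ A B eqI wA wB e

    end-notIntermediate : ∀ (C₁ C₂ : Cycle) → end C₁ ∈ intermediates N C₂ → ⊥
    end-notIntermediate C₁ C₂ m with ∈-++⁻ (int₁ C₂) m
    ... | inj₁ a = end-notOnFirstPath C₁ C₂ a
    ... | inj₂ b = end-notOnFirstPath C₁ (swap C₂) b

    intermediate-¬hybrid : ∀ (C : Cycle) {y} → y ∈ intermediates N C → ¬ Hybrid N y
    intermediate-¬hybrid C m h with hybrid-isEnd h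
    ... | D , refl = end-notIntermediate D C m

    intermediate-parentUnique : ∀ (C : Cycle) {y} → y ∈ intermediates N C →
                                ∀ {p q} → Arc p y → Arc q y → p ≡ q
    intermediate-parentUnique C m = treeNode-parent-unique (intermediate-¬hybrid C m)

    -- Tracing two cycles with a common end back through tree nodes: if the
    -- first paths enter the end through the same arc, they coincide (or
    -- one starts inside the other, which acyclicity and disjointness rule
    -- out), and likewise the second paths.
    alignedCycles : ∀ (C D : Cycle) → end C ≡ end D → last₁ C ≡ last₁ D → SameCycle N C D
    alignedCycles C D refl l₁ =
      combine (sameLastArc (path₁ C) (path₁ D) l₁ (λ y m → intermediate-parentUnique C (onInt₁ C m)))
              (sameLastArc (path₂ C) (path₂ D) l₂ (λ y m → intermediate-parentUnique C (onInt₂ C m)))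
      where
        l₂ : last₂ C ≡ last₂ D
        l₂ with end-parents C (lastArc (path₂ D))
        ... | inj₁ e = ⊥-elim (lasts-distinct D (trans (sym l₁) (sym e)))
        ... | inj₂ e = sym e
        sC = split C
        sD = split D
        combine : (sC ≡ sD × int₁ C ≡ int₁ D) ⊎ (sC ∈ int₁ D ⊎ sD ∈ int₁ C) →
                  (sC ≡ sD × int₂ C ≡ int₂ D) ⊎ (sC ∈ int₂ D ⊎ sD ∈ int₂ C) → SameCycle N C D
        combine (inj₁ (ss , a)) (inj₁ (_ , b)) = ss , refl , inj₁ (a , b)
        combine (inj₁ (refl , _)) (inj₂ (inj₁ m)) = ⊥-elim (start∉ (path₂ D) m)
        combine (inj₁ (refl , _)) (inj₂ (inj₂ m)) = ⊥-elim (start∉ (path₂ C) m)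
        combine (inj₂ (inj₁ m)) (inj₁ (refl , _)) = ⊥-elim (start∉ (path₁ D) m)
        combine (inj₂ (inj₂ m)) (inj₁ (refl , _)) = ⊥-elim (start∉ (path₁ C) m)
        combine (inj₂ (inj₁ a)) (inj₂ (inj₁ b)) = ⊥-elim (noCommonInt D sC a b)
        combine (inj₂ (inj₂ a)) (inj₂ (inj₂ b)) = ⊥-elim (noCommonInt C sD a b)
        combine (inj₂ (inj₁ a)) (inj₂ (inj₂ b)) =
          ⊥-elim (⊏-asym (from-intermediate (path₁ D) a) (from-intermediate (path₂ C) b))
        combine (inj₂ (inj₂ a)) (inj₂ (inj₁ b)) =
          ⊥-elim (⊏-asym (from-intermediate (path₁ C) a) (from-intermediate (path₂ D) b))

    sameEnd⇒SameCycle : ∀ (C D : Cycle) → end C ≡ end D → SameCycle N C D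
    sameEnd⇒SameCycle C D eE with end-parents C (subst (Arc (last₁ D)) (sym eE) (lastArc (path₁ D)))
    ... | inj₁ e = alignedCycles C D eE (sym e)
    ... | inj₂ e with alignedCycles (swap C) D eE (sym e)
    ...   | a , b , inj₁ (x , y) = a , b , inj₂ (y , x)
    ...   | a , b , inj₂ (x , y) = a , b , inj₁ (y , x)

    -- Distinct cycles have distinct ends; a shared node yields a shared
    -- arc, whose target is then an end or an intermediate node of both.
    ON⇒GT : GalledTree N
    ON⇒GT C D ns x a b with end C ≟ end D
    ... | yes eE = ns (sameEnd⇒SameCycle C D eE)
    ... | no ne with sharedNode⇒sharedArc C D a b
    ...   | (u , v) , m₁ , m₂ with cycleArc-target C m₁ | cycleArc-target D m₂
    ...     | inj₁ e₁ | inj₁ e₂ = ne (trans (sym e₁) e₂)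
    ...     | inj₁ e₁ | inj₂ i₂ = end-notIntermediate C D (subst (_∈ intermediates N D) e₁ i₂)
    ...     | inj₂ i₁ | inj₁ e₂ = end-notIntermediate D C (subst (_∈ intermediates N C) e₂ i₁)
    ...     | inj₂ i₁ | inj₂ i₂ = oneNested C D ne v i₁ i₂

  -- 10. A cycle with one node removed stays connected

  CycleMinus : Cycle → Fin n → Fin n → Set
  CycleMinus C x w = w ∈ cycleNodes N C × w ≢ x

  CycleArc : Cycle → Fin n → Fin n → Set
  CycleArc C u v = (u , v) ∈ cycleArcs N C

  onPath₁-onCycle : ∀ (C : Cycle) {y} → OnPath (split C) (end C) (int₁ C) y → y ∈ cycleNodes N C
  onPath₁-onCycle C (inj₁ refl) = here refl
  onPath₁-onCycle C (inj₂ (inj₁ refl)) = end-onCycle C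
  onPath₁-onCycle C (inj₂ (inj₂ m)) = intermediate-onCycle C (onInt₁ C m)

  onPath₂-onCycle : ∀ (C : Cycle) {y} → OnPath (split C) (end C) (int₂ C) y → y ∈ cycleNodes N C
  onPath₂-onCycle C (inj₁ refl) = here refl
  onPath₂-onCycle C (inj₂ (inj₁ refl)) = end-onCycle C
  onPath₂-onCycle C (inj₂ (inj₂ m)) = intermediate-onCycle C (onInt₂ C m)

  onCycle-onPath : ∀ (C : Cycle) {y} → y ∈ cycleNodes N C →
                   OnPath (split C) (end C) (int₁ C) y ⊎ OnPath (split C) (end C) (int₂ C) y
  onCycle-onPath C (here e) = inj₁ (inj₁ e)
  onCycle-onPath C (there (here e)) = inj₁ (inj₂ (inj₁ e))
  onCycle-onPath C (there (there m)) with ∈-++⁻ (int₁ C) m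
  ... | inj₁ a = inj₁ (inj₂ (inj₂ a))
  ... | inj₂ b = inj₂ (inj₂ (inj₂ b))

  toSplitOrEnd : ∀ (C : Cycle) x {u} → u ∈ cycleNodes N C → u ≢ x →
                 UConn N (CycleMinus C x) (CycleArc C) u (split C) ⊎ UConn N (CycleMinus C x) (CycleArc C) u (end C)
  toSplitOrEnd C x {u} m ux with onCycle-onPath C m
  ... | inj₁ o = path-minus-connected x (path₁ C) (λ _ _ a → onArcs₁ C a)
                                     (λ y o' yx → onPath₁-onCycle C o' , yx) u o ux
  ... | inj₂ o = path-minus-connected x (path₂ C) (λ _ _ a → onArcs₂ C a)
                                     (λ y o' yx → onPath₂-onCycle C o' , yx) u o ux

  -- if x is neither split nor end, one of the two paths avoids it
  endToSplit : ∀ (C : Cycle) x → split C ≢ x → end C ≢ x →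
               UConn N (CycleMinus C x) (CycleArc C) (end C) (split C)
  endToSplit C x sx ex with x ∈? int₂ C
  ... | yes x∈₂ = path-connected (path₁ C) (λ _ _ a → onArcs₁ C a)
                                 (λ y o → onPath₁-onCycle C o , avoids o) _ (inj₂ (inj₁ refl))
    where
      avoids : ∀ {y} → OnPath (split C) (end C) (int₁ C) y → y ≢ x
      avoids (inj₁ refl) = sx
      avoids (inj₂ (inj₁ refl)) = ex
      avoids (inj₂ (inj₂ m)) refl = noCommonInt C _ m x∈₂
  ... | no x∉₂ = path-connected (path₂ C) (λ _ _ a → onArcs₂ C a)
                                (λ y o → onPath₂-onCycle C o , avoids o) _ (inj₂ (inj₁ refl))
    where
      avoids : ∀ {y} → OnPath (split C) (end C) (int₂ C) y → y ≢ x
      avoids (inj₁ refl) = sx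
      avoids (inj₂ (inj₁ refl)) = ex
      avoids (inj₂ (inj₂ m)) refl = x∉₂ m

  cycle-minus-connected : ∀ (C : Cycle) x {u v} → u ∈ cycleNodes N C → v ∈ cycleNodes N C → u ≢ x → v ≢ x →
                          UConn N (CycleMinus C x) (CycleArc C) u v
  cycle-minus-connected C x mu mv ux vx = join (toSplitOrEnd C x mu ux) (toSplitOrEnd C x mv vx)
    where
      P = CycleMinus C x
      link : P (end C) → P (split C) → UConn N P (CycleArc C) (end C) (split C)
      link pe ps = endToSplit C x (proj₂ ps) (proj₂ pe)
      join : ∀ {u v} → UConn N P (CycleArc C) u (split C) ⊎ UConn N P (CycleArc C) u (end C) →
                       UConn N P (CycleArc C) v (split C) ⊎ UConn N P (CycleArc C) v (end C) →
                       UConn N P (CycleArc C) u v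
      join (inj₁ a) (inj₁ b) = conn-trans a (conn-sym b)
      join (inj₂ a) (inj₂ b) = conn-trans a (conn-sym b)
      join (inj₁ a) (inj₂ b) = conn-trans a (conn-trans (conn-sym (link (conn-end b) (conn-end a))) (conn-sym b))
      join (inj₂ a) (inj₁ b) = conn-trans a (conn-trans (link (conn-end a) (conn-end b)) (conn-sym b))

  -- 11. Level-1 implies 1-nested

  -- Two cycles sharing the arc (a , b) form a biconnected subgraph:
  -- after removing any node x, every node is connected within its own
  -- cycle to a common node (a, or b if a = x).
  module Union (C D : Cycle) (a b : Fin n) (a∈C : (a , b) ∈ cycleArcs N C) (a∈D : (a , b) ∈ cycleArcs N D) where
    OnUnion : Fin n → Set
    OnUnion w = w ∈ cycleNodes N C ⊎ w ∈ cycleNodes N D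

    UnionArc : Fin n → Fin n → Set
    UnionArc u v = CycleArc C u v ⊎ CycleArc D u v

    union : Subgraph N
    union = record
      { S = OnUnion ; A = UnionArc
      ; A⊆arc = λ { u v (inj₁ m) → cycleArc-isArc C m ; u v (inj₂ m) → cycleArc-isArc D m }
      ; A⊆S = λ { u v (inj₁ m) → inj₁ (cycleArc-source C m) , inj₁ (cycleArc-targetNode C m)
                ; u v (inj₂ m) → inj₂ (cycleArc-source D m) , inj₂ (cycleArc-targetNode D m) } }

    UnionMinus : Fin n → Fin n → Set
    UnionMinus x w = OnUnion w × w ≢ x

    commonNode : ∀ x → Σ (Fin n) λ y → y ≢ x × y ∈ cycleNodes N C × y ∈ cycleNodes N D
    commonNode x with a ≟ x
    ... | yes refl = b , (λ e → ⊏-≢ (⊏-arc (cycleArc-isArc C a∈C)) (sym e)) ,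
                     cycleArc-targetNode C a∈C , cycleArc-targetNode D a∈D
    ... | no ax = a , ax , cycleArc-source C a∈C , cycleArc-source D a∈D

    union-minus-connected : ∀ x u v → OnUnion u → OnUnion v → u ≢ x → v ≢ x →
                            UConn N (UnionMinus x) UnionArc u v
    union-minus-connected x u v su sv ux vx with commonNode x
    ... | y , yx , y∈C , y∈D = conn-trans (toCommon su ux) (conn-sym (toCommon sv vx))
      where
        toCommon : ∀ {w} → OnUnion w → w ≢ x → UConn N (UnionMinus x) UnionArc w y
        toCommon (inj₁ m) wx = conn-mono (λ w p → inj₁ (proj₁ p) , proj₂ p) (λ _ _ m → inj₁ m)
                                         (cycle-minus-connected C x m y∈C wx yx)
        toCommon (inj₂ m) wx = conn-mono (λ w p → inj₂ (proj₁ p) , proj₂ p) (λ _ _ m → inj₂ m)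
                                         (cycle-minus-connected D x m y∈D wx yx)

    -- plain connectivity: remove a node of C avoiding both endpoints
    union-connected : ∀ u v → OnUnion u → OnUnion v → UConn N OnUnion UnionArc u v
    union-connected u v su sv with intermediate-exists C
    ... | i , i∈C with pickAvoiding (split C) (end C) i (split≢end C)
                         (λ e → intermediate≢split C i∈C (sym e)) (λ e → intermediate≢end C i∈C (sym e)) u v
    ...   | x , ux , vx = conn-mono (λ w p → proj₁ p) (λ _ _ m → m) (union-minus-connected x u v su sv ux vx)

    union-biconnected : Biconnected N union
    union-biconnected = union-connected , (λ x u v _ su sv ux vx → union-minus-connected x u v su sv ux vx)

  -- two cycles with different ends sharing an intermediate node share an
  -- arc; their union is biconnected and contains both (hybrid) ends
  L1⇒ON : Level1 N → OneNested N
  L1⇒ON level1 C D ne x x∈C x∈D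
    with sharedNode⇒sharedArc C D (intermediate-onCycle C x∈C) (intermediate-onCycle D x∈D)
  ... | (a , b) , a∈C , a∈D =
    ne (level1 union union-biconnected (end C) (end D) (inj₁ (end-onCycle C)) (inj₂ (end-onCycle D))
               (end-hybrid C) (end-hybrid D))
    where open Union C D a b a∈C a∈D

  -- 12. Descendant sets in a galled tree

  module GalledTreeFacts (galled : GalledTree N) where

    hybrid-onCycle-isEnd : ∀ (C : Cycle) {h} → Hybrid N h → h ∈ cycleNodes N C → h ≡ end C
    hybrid-onCycle-isEnd C hh (here e) = ⊥-elim (split-¬hybrid C (subst (Hybrid N) e hh))
    hybrid-onCycle-isEnd C hh (there (here e)) = e
    hybrid-onCycle-isEnd C hh (there (there im)) with hybrid-isEnd hh
    ... | D , refl = ⊥-elim (galled D C (differentEnds D C (intermediate≢end C im))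
                                    (end D) (end-onCycle D) (intermediate-onCycle C im))

    -- Every parent of a proper descendant y' of a split is again below the
    -- split: otherwise the cycle ending at y' through that parent would
    -- pass through the split.
    split-closedUnderParents : ∀ (C : Cycle) {y y'} → Arc y y' → split C ⊏ y' → ¬ split C ≼ y → ⊥
    split-closedUnderParents C {y} {y'} e (ms , ws) s⋠y with y' ≟ end C
    ... | yes refl with end-parents C e
    ...   | inj₁ refl = s⋠y (≼-lastOf (path₁ C) (here refl))
    ...   | inj₂ refl = s⋠y (≼-lastOf (path₂ C) (here refl))
    split-closedUnderParents C {y} {y'} e (ms , ws) s⋠y | no y'≢h =
      galled D C (differentEnds D C (λ q → y'≢h (trans (sym (CycleThrough.endEq X)) q)))
             (split C) (cycleThrough-onCycle X) (here refl)
      where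
        X = cycleThrough ws e (λ q → s⋠y (subst (split C ≼_) q (≼-lastOf ws (here refl)))) (split C ≼_)
                         (λ z z≼y s≼z → s⋠y (≼-trans s≼z z≼y)) (λ z m → inj₂ (from-intermediate ws m))
        D = CycleThrough.cyc X

    -- Let d be a child, off the cycle C, of an inner node v of C.  Every
    -- parent of a descendant of d is again below d, except v itself as a
    -- parent of d: otherwise a second cycle would pass through v.
    detour-closedUnderParents : ∀ (C : Cycle) {v d} → v ∈ intermediates N C → Arc v d → d ∉ cycleNodes N C →
                                ∀ {y y'} → Arc y y' → d ≼ y' → ¬ d ≼ y → (y' ≡ d → y ≢ v) → ⊥
    detour-closedUnderParents C {v} {d} v∈C evd d∉C e (inj₁ refl) d⋠y y≢v =
      galled D C (differentEnds D C endD≢endC) v (cycleThrough-onCycle X) (intermediate-onCycle C v∈C)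
      where
        X = cycleThrough (edge evd) e (λ q → y≢v refl (sym q)) (d ≼_)
                         (λ z z≼y d≼z → d⋠y (≼-trans d≼z z≼y)) (λ z ())
        D = CycleThrough.cyc X
        endD≢endC : end D ≢ end C
        endD≢endC q = d∉C (subst (_∈ cycleNodes N C) (trans (sym q) (CycleThrough.endEq X)) (end-onCycle C))
    detour-closedUnderParents C {v} {d} v∈C evd d∉C e (inj₂ (ms , wd)) d⋠y _ =
      galled D C (λ same → d∉C (SameCycle-int₁ {D} {C} same d∈D))
             v (cycleThrough-onCycle X) (intermediate-onCycle C v∈C)
      where
        below-d : ∀ z → z ∈ d ∷ ms → d ≼ z
        below-d z (here refl) = inj₁ refl
        below-d z (there m) = inj₂ (from-intermediate wd m)
        X = cycleThrough (step evd wd) e (λ q → d⋠y (subst (d ≼_) q (≼-lastOf wd (here refl)))) (d ≼_)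
                         (λ z z≼y d≼z → d⋠y (≼-trans d≼z z≼y)) below-d
        D = CycleThrough.cyc X
        d∈D : d ∈ int₁ D
        d∈D with CycleThrough.covers X d (there (here refl))
        ... | here q = ⊥-elim (CycleThrough.split-¬R X (subst (d ≼_) q (inj₁ refl)))
        ... | there m = m

    -- ... consequently the end of C is not below such a child d: the part
    -- of C from v to its end would have to enter the descendants of d
    detour-notAbove : ∀ (C : Cycle) {v d B} → v ∈ intermediates N C → Arc v d → d ∉ cycleNodes N C →
                      Walk arc v (end C) B → (∀ {z} → z ∈ B → z ∈ cycleNodes N C) → ¬ d ≼ end C
    detour-notAbove C {v} {d} {B} v∈C evd d∉C wB B⊆C d≼h =
      crossWalk (λ w → ¬ d ≼ w) wB d⋠v (λ k → k d≼h) cross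
      where
        d⋠v : ¬ d ≼ v
        d⋠v (inj₁ refl) = ⊏-irrefl (⊏-arc evd)
        d⋠v (inj₂ p) = ⊏-asym p (⊏-arc evd)
        onC : ∀ {y'} → y' ≡ end C ⊎ y' ∈ B → y' ∈ cycleNodes N C
        onC (inj₁ refl) = end-onCycle C
        onC (inj₂ m) = B⊆C m
        cross : ∀ y y' → Arc y y' → ¬ d ≼ y → ¬ ¬ d ≼ y' → (y' ≡ end C ⊎ y' ∈ B) → ⊥
        cross y y' e d⋠y ¬¬d≼y' pos =
          ¬¬d≼y' λ d≼y' →
            detour-closedUnderParents C v∈C evd d∉C e d≼y' d⋠y (λ { refl → ⊥-elim (d∉C (onC pos)) })

    detour-notAboveEnd : ∀ (C : Cycle) {v d} → v ∈ intermediates N C → Arc v d → d ∉ cycleNodes N C → ¬ d ≼ end C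
    detour-notAboveEnd C v∈C evd d∉C with ∈-++⁻ (int₁ C) v∈C
    ... | inj₁ a with splitWalk (path₁ C) a
    ...   | A , B , eq , _ , wB = detour-notAbove C v∈C evd d∉C wB
                                    (λ m → intermediate-onCycle C (onInt₁ C (subst (_ ∈_) (sym eq) (∈-++⁺ʳ A (there m)))))
    detour-notAboveEnd C v∈C evd d∉C | inj₂ b with splitWalk (path₂ C) b
    ...   | A , B , eq , _ , wB = detour-notAbove C v∈C evd d∉C wB
                                    (λ m → intermediate-onCycle C (onInt₂ C (subst (_ ∈_) (sym eq) (∈-++⁺ʳ A (there m)))))

    -- 13. Galled trees are level-1

    module InBiconnected (G : Subgraph N) (bic : Biconnected N G) where
      open Subgraph G

      Avoiding : Fin n → Fin n → Set
      Avoiding x w = S w × w ≢ x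

      connectedAvoiding : ∀ x {u v} → S u → S v → u ≢ x → v ≢ x → ¬ ¬ UConn N (Avoiding x) A u v
      connectedAvoiding x su sv ux vx k =
        refuteByCases (λ sx → k (proj₂ bic x _ _ sx su sv ux vx))
                      (λ ¬sx → k (conn-mono (λ w sw → sw , (λ { refl → ¬sx sw })) (λ _ _ a → a)
                                            (proj₁ bic _ _ su sv)))

      -- Fix a cycle C whose end is in G and a node h' of G off C.
      module OffCycle (C : Cycle) {h'} (sh : S (end C)) (sh' : S h') (h'∉C : h' ∉ cycleNodes N C) where

        -- If h' is not below the split, the end of C connects to h' in
        -- G − split, so an arc of G enters the descendants of the split
        -- from outside.
        notBelowSplit : ¬ split C ≼ h' → ⊥
        notBelowSplit s⋠h' =
          connectedAvoiding (split C) sh sh' (λ e → split≢end C (sym e)) (λ { refl → s⋠h' (inj₁ refl) })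
            λ c → entersDescendants (split C) A⊆arc c (inj₂ (_ , path₁ C)) s⋠h'
                    λ y y' py _ e s≼y s⋠y' → split-closedUnderParents C e (≼∧≢⇒⊏ s≼y (proj₂ py)) s⋠y'

        -- If h' is below the split, a path from the split to h' leaves C
        -- across an arc y → y'.  Then y is not the split (its children are
        -- on C), nor the end (h' is not below it), and for an inner y the
        -- end of C connects to h' in G − y, entering the descendants of y'.
        leavesCycle : split C ≼ h' → ¬ end C ⊏ h' → ⊥
        leavesCycle (inj₁ refl) _ = h'∉C (here refl)
        leavesCycle (inj₂ (ms , ws)) h⊀h' = crossWalk (_∈ cycleNodes N C) ws (here refl) h'∉C exit
          where
            exit : ∀ y y' → Arc y y' → y ∈ cycleNodes N C → y' ∉ cycleNodes N C → (y' ≡ h' ⊎ y' ∈ ms) → ⊥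
            exit y y' e y∈C y'∉C pos = fromNode y∈C
              where
                below : y' ≡ h' ⊎ y' ∈ ms → y' ≼ h'
                below (inj₁ q) = inj₁ q
                below (inj₂ m) = inj₂ (to-intermediate ws m)
                y'≼h' : y' ≼ h'
                y'≼h' = below pos
                fromNode : y ∈ cycleNodes N C → ⊥
                fromNode (here refl) with split-children C e
                ... | inj₁ q = y'∉C (subst (_∈ cycleNodes N C) (sym q) (first₁-onCycle C))
                ... | inj₂ q = y'∉C (subst (_∈ cycleNodes N C) (sym q) (first₂-onCycle C))
                fromNode (there (here refl)) = h⊀h' (⊏-≼-trans (⊏-arc e) y'≼h')
                fromNode (there (there v∈C)) =
                  connectedAvoiding y sh' sh (λ q → h'∉C (subst (_∈ cycleNodes N C) (sym q) y∈C))
                                    (λ q → intermediate≢end C v∈C (sym q))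
                    λ c → entersDescendants y' A⊆arc c y'≼h' (detour-notAboveEnd C v∈C e y'∉C)
                      λ z z' _ pz' a y'≼z y'⋠z' →
                        detour-closedUnderParents C v∈C e y'∉C a y'≼z y'⋠z' (λ _ → proj₂ pz')

      twoHybrids : ∀ {h h'} → Hybrid N h → Hybrid N h' → S h → S h' → h ≢ h' → ¬ h ⊏ h' → ⊥
      twoHybrids {h' = h'} hh hh' sh sh' h≢h' h⊀h' with hybrid-isEnd hh
      ... | C , refl with h' ∈? cycleNodes N C
      ...   | yes h'∈C = h≢h' (sym (hybrid-onCycle-isEnd C hh' h'∈C))
      ...   | no h'∉C = refuteByCases (λ below → leavesCycle below h⊀h') notBelowSplit
        where open OffCycle C sh sh' h'∉C

    GT⇒L1 : Level1 N
    GT⇒L1 G bic h₁ h₂ s₁ s₂ hy₁ hy₂ with h₁ ≟ h₂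
    ... | yes e = e
    ... | no ne = ⊥-elim (refuteByCases
                            (λ h₁⊏h₂ → twoHybrids hy₂ hy₁ s₂ s₁ (λ e → ne (sym e)) (⊏-asym h₁⊏h₂))
                            (twoHybrids hy₁ hy₂ s₁ s₂ ne))
      where open InBiconnected G bic

proposition4 : (N : Network) → Binary N
    → (Level1 N ⇔ OneNested N) × (OneNested N ⇔ WeaklyGalledTree N)
    × (WeaklyGalledTree N ⇔ GalledTree N)
proposition4 N bin =
    mk⇔ L1⇒ON (λ on → GT⇒L1 (ON⇒GT on))
  , mk⇔ (λ on → GT⇒WGT (ON⇒GT on)) WGT⇒ON
  , mk⇔ WGT⇒GT GT⇒WGT
  where
    open BinaryNetwork N bin
    open OneNestedFacts using (ON⇒GT)
    open GalledTreeFacts using (GT⇒L1)
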